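{- If the complete graph $K_8$ is edge-colored with exactly $17$ colors and contains no rainbow $K_4$, then it contains a rainbow subgraph isomorphic to the Turán graph $T_{8,2}$ (that is, $K_{4,4}$).
   Context: Edge colorings are arbitrary (not necessarily proper). A subgraph is rainbow if its edges have pairwise distinct colors. $T_{n,r}$ denotes the complete $r$-partite graph on $n$ vertices with part sizes differing by at most one. -}

module Defs where

open import Data.Nat using (ℕ; _+_)
open import Data.Sum using (_⊎_)
open import Data.Fin using (Fin; _↑ˡ_; _↑ʳ_)
open import Data.Product using (Σ; ∃; _×_; _,_)
open import Relation.Binary.PropositionalEquality using (_≡_; _≢_)
open import Function.Definitions using (Injective)

-- An edge-coloring of the complete graph K_n with colors from a set C:
-- a function on ordered pairs of vertices that is symmetric; values on
-- the diagonal (u , u) are irrelevant (they are never consulted).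
record EdgeColoring (n : ℕ) (C : Set) : Set where
  field
    col : Fin n → Fin n → C
    sym : ∀ u v → col u v ≡ col v u
open EdgeColoring public

UsesAllColors : ∀ {n C} → EdgeColoring n C → Set
UsesAllColors {n} {C} χ = ∀ (k : C) → Σ (Fin n) λ u → Σ (Fin n) λ v → (u ≢ v) × (col χ u v ≡ k)

HasRainbowK4 : ∀ {n C} → EdgeColoring n C → Set
HasRainbowK4 {n} χ =
  Σ (Fin 4 → Fin n) λ f → Injective _≡_ _≡_ f ×
    (∀ i j k l → i ≢ j → k ≢ l →
       col χ (f i) (f j) ≡ col χ (f k) (f l) →
       (i ≡ k × j ≡ l) ⊎ (i ≡ l × j ≡ k))

-- A rainbow copy of K_{a,b}: an injective map of the a + b vertices of
-- K_{a,b} (left part = Fin a embedded by ↑ˡ, right part by ↑ʳ) into the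
-- vertices, such that the a·b edges between the parts get pairwise
-- distinct colors.
HasRainbowKab : ∀ {n C} → (a b : ℕ) → EdgeColoring n C → Set
HasRainbowKab {n} a b χ =
  Σ (Fin (a + b) → Fin n) λ f → Injective _≡_ _≡_ f ×
    (∀ (i i' : Fin a) (j j' : Fin b) →
       col χ (f (i ↑ˡ b)) (f (a ↑ʳ j)) ≡ col χ (f (i' ↑ˡ b)) (f (a ↑ʳ j')) →
       (i ≡ i') × (j ≡ j'))

{-# OPTIONS --safe #-}

-- For a vertex set S, call v ∈ S essential for a colour k of S if k disappears when v is deleted.
-- An essential vertex of k is an endpoint of every k-edge, so k has at most two of them, and two
-- exactly when k lies on a single edge. Double counting pairs (v, k) with v essential for k gives
--   (|S| − 2) c(S) + Δ(S) ≤ Σ_{v∈S} c(S − v),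
-- where c counts colours and the deficit Δ(S) sums 2 − #essential over the colours of S. If every
-- colour has an essential vertex, deleting one for each colour with fewer than two leaves at least
-- |S| − Δ(S) vertices all of whose colours lie on single edges, i.e. a rainbow clique. Without a
-- rainbow K4 this yields c ≤ 1, 3, 5, 7, 10, 13 on 2, ..., 7 vertices, and 17 colours on K8 force
-- Δ(K8) ≤ 2. Unless some colour X has no essential vertex this gives a rainbow K4 again. Otherwise
-- every other colour lies on a single edge; the graph of edges not coloured X has minimum degree 4
-- (deleting a vertex loses at least 17 − 13 colours) and no K4 minus an edge, so it is
-- triangle-free, which on 8 vertices forces a K_{4,4} all of whose edges have distinct colours.

module Submission where

open import Defs renaming (sym to col-sym)
open import Data.Nat.Properties hiding (_≟_)
open import Algebra.Properties.Semiring.Sum +-*-semiring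
  using (sum; ∑-comm; ∑-distrib-+; *-distribˡ-sum; *-distribʳ-sum; sum-cong-≗; sum-remove;
         sum-replicate-zero)
open import Data.Bool using (Bool; true; false; T; _∧_; not)
open import Data.Bool.Properties using (T-∧)
open import Data.Empty using (⊥; ⊥-elim)
open import Data.Fin using (Fin; zero; suc; _≟_; punchOut; _↑ˡ_; _↑ʳ_; splitAt; join)
open import Data.Fin.Patterns using (0F; 1F; 2F; 3F)
open import Data.Fin.Properties using (any?; punchIn-punchOut; join-splitAt)
open import Data.Nat using (ℕ; zero; suc; _+_; _*_; _∸_; _≤_; _<_; z≤n; s≤s; s≤s⁻¹)
  renaming (_≟_ to _≟ℕ_)
open import Data.Product using (Σ; ∃; _×_; _,_; proj₁; proj₂)
import Data.Product as Product
open import Data.Sum using (_⊎_; inj₁; inj₂; [_,_]′)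
import Data.Sum as Sum
open import Data.Unit using (tt)
open import Data.Vec.Functional using (_∷_; []; _++_; removeAt)
open import Data.Vec.Functional.Properties using (lookup-++ˡ; lookup-++ʳ)
open import Function using (_∘_; const)
open import Function.Bundles using (Equivalence)
open import Function.Definitions using (Injective)
open import Relation.Binary.PropositionalEquality
open import Relation.Nullary using (¬_; yes; no; contradiction)
open import Relation.Nullary.Decidable using (⌊_⌋; toWitness; fromWitness; T?; _×-dec_; ¬?; ⌊⌋-map′)
open import Relation.Unary using (Decidable)

-- Subsets are characteristic functions, so that a cardinality is a sum and double counting is ∑-comm.
Subset : ℕ → Set
Subset n = Fin n → Bool

private
  variable
    n m : ℕ

ind : Bool → ℕ
ind false = 0
ind true  = 1

full : Subset n
full _ = true

_⊆_ : Subset n → Subset n → Set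
p ⊆ q = ∀ {i} → T (p i) → T (q i)

-- Opaque, so that unification sees subsets and cardinalities rather than the sums they unfold to.
opaque
  ∣_∣ : Subset n → ℕ
  ∣ p ∣ = sum (ind ∘ p)

  ⁅_⁆ : Fin n → Subset n
  ⁅ a ⁆ i = ⌊ i ≟ a ⌋

  infixl 6 _∖_
  infixl 7 _∩_

  _∖_ : Subset n → Subset n → Subset n
  (p ∖ q) i = p i ∧ not (q i)

  _∩_ : Subset n → Subset n → Subset n
  (p ∩ q) i = p i ∧ q i

infixl 6 _─_

_─_ : Subset n → Fin n → Subset n
p ─ a = p ∖ ⁅ a ⁆

sum-mono-≤ : {f g : Fin n → ℕ} → (∀ i → f i ≤ g i) → sum f ≤ sum g
sum-mono-≤ {zero}  _   = z≤n
sum-mono-≤ {suc n} f≤g = +-mono-≤ (f≤g zero) (sum-mono-≤ (f≤g ∘ suc))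

fᵢ≤sum : (f : Fin n → ℕ) (i : Fin n) → f i ≤ sum f
fᵢ≤sum {suc n} f i = ≤-trans (m≤m+n (f i) _) (≤-reflexive (sym (sum-remove {i = i} f)))

fᵢ+fⱼ≤sum : (f : Fin n → ℕ) {i j : Fin n} → i ≢ j → f i + f j ≤ sum f
fᵢ+fⱼ≤sum {suc n} f {i} {j} i≢j = begin
  f i + f j                          ≡⟨ cong (λ x → f i + f x) (sym (punchIn-punchOut i≢j)) ⟩
  f i + removeAt f i (punchOut i≢j)  ≤⟨ +-monoʳ-≤ (f i) (fᵢ≤sum (removeAt f i) _) ⟩
  f i + sum (removeAt f i)           ≡⟨ sum-remove f ⟨
  sum f                              ∎
  where open ≤-Reasoning

ind-T : ∀ {b} → T b → ind b ≡ 1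
ind-T {true} _ = refl

ind-mono : ∀ {b c} → (T b → T c) → ind b ≤ ind c
ind-mono {false}          _   = z≤n
ind-mono {true}  {true}   _   = ≤-refl
ind-mono {true}  {false} b⇒c = ⊥-elim (b⇒c tt)

ind-cover : ∀ {b c d} → (T b → T c ⊎ T d) → ind b ≤ ind c + ind d
ind-cover {false}                 _ = z≤n
ind-cover {true} {true}           _ = s≤s z≤n
ind-cover {true} {false} {true}   _ = ≤-refl
ind-cover {true} {false} {false} b⇒c⊎d with b⇒c⊎d tt
... | inj₁ ()
... | inj₂ ()

ind-∖ : ∀ {b c} → (T c → T b) → ind b ≡ ind (b ∧ not c) + ind c
ind-∖ {true}  {true}  _   = refl
ind-∖ {true}  {false} _   = refl
ind-∖ {false} {true}  c⇒b = ⊥-elim (c⇒b tt)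
ind-∖ {false} {false} _   = refl

ind-three : ∀ b c d → ind b + ind c + ind d ≤ 1 + ind (c ∧ d) + ind (b ∧ d) + ind (b ∧ c)
ind-three false false false = z≤n
ind-three false false true  = ≤-refl
ind-three false true  false = ≤-refl
ind-three false true  true  = ≤-refl
ind-three true  false false = ≤-refl
ind-three true  false true  = ≤-refl
ind-three true  true  false = ≤-refl
ind-three true  true  true  = s≤s (s≤s (s≤s z≤n))

opaque
  unfolding ⁅_⁆ _∖_ _∩_

  ∈∩⁻ : {p q : Subset n} {i : Fin n} → T ((p ∩ q) i) → T (p i) × T (q i)
  ∈∩⁻ = Equivalence.to T-∧

  ∈⁅⁆⁺ : {i a : Fin n} → i ≡ a → T (⁅ a ⁆ i)
  ∈⁅⁆⁺ = fromWitness

  ∈⁅⁆⁻ : {i a : Fin n} → T (⁅ a ⁆ i) → i ≡ a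
  ∈⁅⁆⁻ = toWitness

  ∈∖⁺ : {p q : Subset n} {i : Fin n} → T (p i) → ¬ T (q i) → T ((p ∖ q) i)
  ∈∖⁺ {p = p} {q} {i} i∈p i∉q with p i | q i
  ... | true  | true  = i∉q tt
  ... | true  | false = tt

  ∈∖⁻ : {p q : Subset n} {i : Fin n} → T ((p ∖ q) i) → T (p i) × ¬ T (q i)
  ∈∖⁻ {p = p} {q} {i} i∈p∖q with p i | q i
  ... | true  | false = tt , λ ()

∈─⁺ : {p : Subset n} {i a : Fin n} → T (p i) → i ≢ a → T ((p ─ a) i)
∈─⁺ i∈p i≢a = ∈∖⁺ i∈p (i≢a ∘ ∈⁅⁆⁻)

∈─⁻ : {p : Subset n} {i a : Fin n} → T ((p ─ a) i) → T (p i) × i ≢ a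
∈─⁻ i∈p─a = proj₁ (∈∖⁻ i∈p─a) , proj₂ (∈∖⁻ i∈p─a) ∘ ∈⁅⁆⁺

opaque
  unfolding ∣_∣ ⁅_⁆ _∖_ _∩_

  count-mono : {p q : Subset n} → p ⊆ q → ∣ p ∣ ≤ ∣ q ∣
  count-mono {p = p} {q} p⊆q = sum-mono-≤ {f = ind ∘ p} {ind ∘ q} (λ i → ind-mono (p⊆q {i}))

  count-cover : {p q r : Subset n} → (∀ {i} → T (p i) → T (q i) ⊎ T (r i)) →
                ∣ p ∣ ≤ ∣ q ∣ + ∣ r ∣
  count-cover {p = p} {q} {r} cover =
    ≤-trans (sum-mono-≤ {f = ind ∘ p} (λ i → ind-cover (cover {i})))
            (≤-reflexive (∑-distrib-+ (ind ∘ q) (ind ∘ r)))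

  count-∖ : {p q : Subset n} → q ⊆ p → ∣ p ∣ ≡ ∣ p ∖ q ∣ + ∣ q ∣
  count-∖ {p = p} {q} q⊆p =
    trans (sum-cong-≗ {x = ind ∘ p} (λ i → ind-∖ (q⊆p {i})))
          (∑-distrib-+ (ind ∘ (p ∖ q)) (ind ∘ q))

  count-∅ : ∣ (λ (_ : Fin n) → false) ∣ ≡ 0
  count-∅ {n} = sum-replicate-zero n

  count-full : ∣ full {n} ∣ ≡ n
  count-full {zero}  = refl
  count-full {suc n} = cong suc (count-full {n})

  count-⁅⁆ : (a : Fin n) → ∣ ⁅ a ⁆ ∣ ≡ 1
  count-⁅⁆ {suc n} zero    = cong suc (count-∅ {n})
  count-⁅⁆ {suc n} (suc a) =
    trans (sum-cong-≗ (λ i → cong ind (⌊⌋-map′ _ _ (i ≟ a)))) (count-⁅⁆ a)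

  ∣∣≡sum : {p : Subset n} → ∣ p ∣ ≡ sum (ind ∘ p)
  ∣∣≡sum = refl

  count-* : (p : Subset n) (c : ℕ) → ∣ p ∣ * c ≡ sum (λ i → ind (p i) * c)
  count-* p c = *-distribʳ-sum c (ind ∘ p)

  ∑-count-comm : (r : Fin m → Subset n) → sum (λ j → ∣ r j ∣) ≡ sum (λ i → ∣ (λ j → r j i) ∣)
  ∑-count-comm r = ∑-comm (λ j i → ind (r j i))

  ∈⇒∣∣>0 : {p : Subset n} {i : Fin n} → T (p i) → 0 < ∣ p ∣
  ∈⇒∣∣>0 {p = p} {i} i∈p = ≤-trans (ind-mono {true} (const i∈p)) (fᵢ≤sum (ind ∘ p) i)

count-─ : {p : Subset n} {a : Fin n} → T (p a) → ∣ p ∣ ≡ suc ∣ p ─ a ∣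
count-─ {p = p} {a} a∈p = begin
  ∣ p ∣                 ≡⟨ count-∖ (λ i∈⁅a⁆ → subst (T ∘ p) (sym (∈⁅⁆⁻ i∈⁅a⁆)) a∈p) ⟩
  ∣ p ─ a ∣ + ∣ ⁅ a ⁆ ∣ ≡⟨ cong (∣ p ─ a ∣ +_) (count-⁅⁆ a) ⟩
  ∣ p ─ a ∣ + 1         ≡⟨ +-comm _ 1 ⟩
  suc ∣ p ─ a ∣         ∎
  where open ≡-Reasoning

∣∣>0⇒∃ : {p : Subset n} → 0 < ∣ p ∣ → ∃ λ i → T (p i)
∣∣>0⇒∃ {p = p} ∣p∣>0 with any? (λ i → T? (p i))
... | yes ∃i = ∃i
... | no  ∄i = contradiction (begin-strict
  0                        <⟨ ∣p∣>0 ⟩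
  ∣ p ∣                    ≤⟨ count-mono (λ i∈p → ∄i (_ , i∈p)) ⟩
  ∣ (λ _ → false) ∣        ≡⟨ count-∅ ⟩
  0                        ∎) (λ ())
  where open ≤-Reasoning

choose : ∀ {k} {p : Subset n} → k ≤ ∣ p ∣ →
         Σ (Fin k → Fin n) λ f → Injective _≡_ _≡_ f × (∀ i → T (p (f i)))
choose {k = zero}  _ = (λ ()) , (λ {}) , λ ()
choose {k = suc k} {p = p} k<∣p∣ = a ∷ g , injective , members
  where
  a∈p = ∣∣>0⇒∃ (≤-trans (s≤s z≤n) k<∣p∣)
  a = proj₁ a∈p
  rest = choose {p = p ─ a} (s≤s⁻¹ (subst (suc k ≤_) (count-─ (proj₂ a∈p)) k<∣p∣))
  g = proj₁ rest
  g-injective = proj₁ (proj₂ rest)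
  g≢a : ∀ i → g i ≢ a
  g≢a i = proj₂ (∈─⁻ (proj₂ (proj₂ rest) i))
  injective : Injective _≡_ _≡_ (a ∷ g)
  injective {zero}  {zero}  _   = refl
  injective {zero}  {suc j} a≡g = contradiction (sym a≡g) (g≢a j)
  injective {suc i} {zero}  g≡a = contradiction g≡a (g≢a i)
  injective {suc i} {suc j} g≡g = cong suc (g-injective g≡g)
  members : ∀ i → T (p ((a ∷ g) i))
  members zero    = proj₂ a∈p
  members (suc i) = proj₁ (∈─⁻ (proj₂ (proj₂ rest) i))

p⊆q∧∣q∣≤∣p∣⇒q⊆p : {p q : Subset n} → p ⊆ q → ∣ q ∣ ≤ ∣ p ∣ → q ⊆ p
p⊆q∧∣q∣≤∣p∣⇒q⊆p {p = p} {q} p⊆q ∣q∣≤∣p∣ {i} i∈q with T? (p i)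
... | yes i∈p = i∈p
... | no  i∉p = contradiction ∣q∣≤∣p∣ (<⇒≱ (begin-strict
  ∣ p ∣      ≤⟨ count-mono (λ j∈p → ∈─⁺ (p⊆q j∈p) (λ { refl → i∉p j∈p })) ⟩
  ∣ q ─ i ∣  <⟨ ≤-reflexive (sym (count-─ i∈q)) ⟩
  ∣ q ∣      ∎))
  where open ≤-Reasoning

count-≤-∑ : {q : Subset n} (r : Fin m → Subset n) →
            (∀ {i} → T (q i) → ∃ λ j → T (r j i)) → ∣ q ∣ ≤ sum (λ j → ∣ r j ∣)
count-≤-∑ {q = q} r covered = begin
  ∣ q ∣                                ≡⟨ ∣∣≡sum ⟩
  sum (ind ∘ q)                        ≤⟨ sum-mono-≤ pointwise ⟩
  sum (λ i → sum (λ j → ind (r j i)))  ≡⟨ ∑-comm (λ i j → ind (r j i)) ⟩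
  sum (λ j → sum (ind ∘ r j))          ≡⟨ sum-cong-≗ (λ j → ∣∣≡sum {p = r j}) ⟨
  sum (λ j → ∣ r j ∣)                  ∎
  where
  open ≤-Reasoning
  pointwise : ∀ i → ind (q i) ≤ sum (λ j → ind (r j i))
  pointwise i with T? (q i)
  ... | yes i∈q = let (j , i∈rⱼ) = covered i∈q in
                  ≤-trans (ind-mono (const i∈rⱼ)) (fᵢ≤sum (λ j → ind (r j i)) j)
  ... | no  i∉q = ≤-trans (ind-mono {c = false} i∉q) z≤n

count-image : {p : Subset n} {q : Subset m} (f : Fin n → Fin m) →
              (∀ {k} → T (q k) → ∃ λ x → T (p x) × f x ≡ k) → ∣ q ∣ ≤ ∣ p ∣
count-image {n = n} {m = m} {p = p} {q} f onto = begin
  ∣ q ∣                    ≤⟨ count-≤-∑ fibre (λ k∈q → let (x , x∈p , fx≡k) = onto k∈q in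
                                                x , ∈fibre x∈p (∈⁅⁆⁺ (sym fx≡k))) ⟩
  sum (λ x → ∣ fibre x ∣)  ≤⟨ sum-mono-≤ (λ x → ∣∧⁅⁆∣≤ (p x) (f x)) ⟩
  sum (ind ∘ p)            ≡⟨ ∣∣≡sum ⟨
  ∣ p ∣                    ∎
  where
  open ≤-Reasoning
  fibre : Fin n → Subset m
  fibre x k = p x ∧ ⁅ f x ⁆ k
  ∈fibre : ∀ {x k} → T (p x) → T (⁅ f x ⁆ k) → T (fibre x k)
  ∈fibre x∈p k∈⁅fx⁆ = Equivalence.from T-∧ (x∈p , k∈⁅fx⁆)
  ∣∧⁅⁆∣≤ : ∀ b a → ∣ (λ k → b ∧ ⁅ a ⁆ k) ∣ ≤ ind b
  ∣∧⁅⁆∣≤ true  a = ≤-reflexive (count-⁅⁆ a)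
  ∣∧⁅⁆∣≤ false a = ≤-reflexive count-∅

opaque
  unfolding ∣_∣ _∩_

  count-three-overlaps : (p q r : Subset n) →
               ∣ p ∣ + ∣ q ∣ + ∣ r ∣ ≤ n + ∣ q ∩ r ∣ + ∣ p ∩ r ∣ + ∣ p ∩ q ∣
  count-three-overlaps {n = n} p q r = begin
    ∣ p ∣ + ∣ q ∣ + ∣ r ∣
      ≡⟨ cong (_+ ∣ r ∣) (∑-distrib-+ (ind ∘ p) (ind ∘ q)) ⟨
    sum (λ i → ind (p i) + ind (q i)) + ∣ r ∣
      ≡⟨ ∑-distrib-+ (λ i → ind (p i) + ind (q i)) (ind ∘ r) ⟨
    sum (λ i → ind (p i) + ind (q i) + ind (r i))
      ≤⟨ sum-mono-≤ (λ i → ind-three (p i) (q i) (r i)) ⟩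
    sum (λ i → 1 + ind ((q ∩ r) i) + ind ((p ∩ r) i) + ind ((p ∩ q) i))
      ≡⟨ ∑-distrib-+ (λ i → 1 + ind ((q ∩ r) i) + ind ((p ∩ r) i)) (ind ∘ (p ∩ q)) ⟩
    sum (λ i → 1 + ind ((q ∩ r) i) + ind ((p ∩ r) i)) + ∣ p ∩ q ∣
      ≡⟨ cong (_+ ∣ p ∩ q ∣) (∑-distrib-+ (λ i → 1 + ind ((q ∩ r) i)) (ind ∘ (p ∩ r))) ⟩
    sum (λ i → 1 + ind ((q ∩ r) i)) + ∣ p ∩ r ∣ + ∣ p ∩ q ∣
      ≡⟨ cong (λ x → x + ∣ p ∩ r ∣ + ∣ p ∩ q ∣) (∑-distrib-+ (λ _ → 1) (ind ∘ (q ∩ r))) ⟩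
    ∣ full {n} ∣ + ∣ q ∩ r ∣ + ∣ p ∩ r ∣ + ∣ p ∩ q ∣
      ≡⟨ cong (λ x → x + ∣ q ∩ r ∣ + ∣ p ∩ r ∣ + ∣ p ∩ q ∣) (count-full {n}) ⟩
    n + ∣ q ∩ r ∣ + ∣ p ∩ r ∣ + ∣ p ∩ q ∣
      ∎
    where open ≤-Reasoning

SamePair : {A : Set} → A → A → A → A → Set
SamePair x y x′ y′ = (x ≡ x′ × y ≡ y′) ⊎ (x ≡ y′ × y ≡ x′)

samePair-sym : {A : Set} {x y x′ y′ : A} → SamePair x y x′ y′ → SamePair x′ y′ x y
samePair-sym (inj₁ (refl , refl)) = inj₁ (refl , refl)
samePair-sym (inj₂ (refl , refl)) = inj₂ (refl , refl)

samePair-via : {A : Set} {x y x′ y′ z z′ : A} →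
               SamePair x y z z′ → SamePair x′ y′ z z′ → SamePair x y x′ y′
samePair-via (inj₁ (refl , refl)) (inj₁ (refl , refl)) = inj₁ (refl , refl)
samePair-via (inj₁ (refl , refl)) (inj₂ (refl , refl)) = inj₂ (refl , refl)
samePair-via (inj₂ (refl , refl)) (inj₁ (refl , refl)) = inj₂ (refl , refl)
samePair-via (inj₂ (refl , refl)) (inj₂ (refl , refl)) = inj₁ (refl , refl)

samePair-of-endpoints : {A : Set} {x y z z′ : A} → x ≢ y → z ≢ z′ →
                        x ≡ z ⊎ y ≡ z → x ≡ z′ ⊎ y ≡ z′ → SamePair x y z z′
samePair-of-endpoints _ z≢z′ (inj₁ refl) (inj₁ refl) = contradiction refl z≢z′
samePair-of-endpoints _ _   (inj₁ refl) (inj₂ refl) = inj₁ (refl , refl)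
samePair-of-endpoints _ _   (inj₂ refl) (inj₁ refl) = inj₂ (refl , refl)
samePair-of-endpoints _ z≢z′ (inj₂ refl) (inj₂ refl) = contradiction refl z≢z′

samePair-injective : {A B : Set} {f : A → B} → Injective _≡_ _≡_ f →
                     ∀ {x y x′ y′} → SamePair (f x) (f y) (f x′) (f y′) → SamePair x y x′ y′
samePair-injective f-inj = Sum.map (Product.map f-inj f-inj) (Product.map f-inj f-inj)

module _ {n m : ℕ} (χ : EdgeColoring n (Fin m)) where

  Edge : Subset n → Fin n → Fin n → Set
  Edge S a b = T (S a) × T (S b) × a ≢ b

  Occurs : Subset n → Fin m → Set
  Occurs S k = ∃ λ a → ∃ λ b → Edge S a b × col χ a b ≡ k

  occurs? : ∀ S → Decidable (Occurs S)
  occurs? S k = any? λ a → any? λ b → (T? (S a) ×-dec T? (S b) ×-dec ¬? (a ≟ b)) ×-dec (col χ a b ≟ k)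

  Essential : Subset n → Fin n → Fin m → Set
  Essential S v k = Occurs S k × T (S v) × ¬ Occurs (S ─ v) k

  opaque
    colours : Subset n → Subset m
    colours S k = ⌊ occurs? S k ⌋

    essential : Subset n → Fin n → Subset m
    essential S v k = ⌊ occurs? S k ×-dec T? (S v) ×-dec ¬? (occurs? (S ─ v) k) ⌋

    colours⁺ : ∀ {S k} → Occurs S k → T (colours S k)
    colours⁺ = fromWitness

    colours⁻ : ∀ {S k} → T (colours S k) → Occurs S k
    colours⁻ = toWitness

    essential⁺ : ∀ {S v k} → Essential S v k → T (essential S v k)
    essential⁺ = fromWitness

    essential⁻ : ∀ {S v k} → T (essential S v k) → Essential S v k
    essential⁻ = toWitness

  weight : Subset n → Fin m → ℕ
  weight S k = ∣ (λ v → essential S v k) ∣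

  AtMostOneEdge : Subset n → Fin m → Set
  AtMostOneEdge S k = ∀ {a b a′ b′} → Edge S a b → Edge S a′ b′ →
                      col χ a b ≡ k → col χ a′ b′ ≡ k → SamePair a b a′ b′

  edge-sym : ∀ {S a b} → Edge S a b → Edge S b a
  edge-sym (a∈S , b∈S , a≢b) = b∈S , a∈S , a≢b ∘ sym

  essential-endpoint : ∀ {S v k a b} → T (essential S v k) → Edge S a b → col χ a b ≡ k →
                       a ≡ v ⊎ b ≡ v
  essential-endpoint {v = v} {a = a} {b} v-ess (a∈S , b∈S , a≢b) ab≡k with a ≟ v | b ≟ v
  ... | yes a≡v | _       = inj₁ a≡v
  ... | no _    | yes b≡v = inj₂ b≡v
  ... | no a≢v  | no b≢v  =
    ⊥-elim (proj₂ (proj₂ (essential⁻ v-ess))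
                  (a , b , (∈─⁺ a∈S a≢v , ∈─⁺ b∈S b≢v , a≢b) , ab≡k))

  essential-image : ∀ {S v k} → T (essential S v k) → ∃ λ x → Edge S v x × col χ v x ≡ k
  essential-image v-ess with proj₁ (essential⁻ v-ess)
  ... | a , b , ab , ab≡k with essential-endpoint v-ess ab ab≡k
  ...   | inj₁ refl = b , ab , ab≡k
  ...   | inj₂ refl = a , edge-sym ab , trans (col-sym χ b a) ab≡k

  weight≤2 : ∀ S k → weight S k ≤ 2 * ind (colours S k)
  weight≤2 S k with T? (colours S k)
  ... | yes k∈S = let (a , b , ab , ab≡k) = colours⁻ k∈S in begin
    weight S k             ≤⟨ count-cover (Sum.map (∈⁅⁆⁺ ∘ sym) (∈⁅⁆⁺ ∘ sym) ∘ endpoint ab ab≡k) ⟩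
    ∣ ⁅ a ⁆ ∣ + ∣ ⁅ b ⁆ ∣  ≡⟨ cong₂ _+_ (count-⁅⁆ a) (count-⁅⁆ b) ⟩
    2                      ≡⟨ cong (2 *_) (ind-T k∈S) ⟨
    2 * ind (colours S k)  ∎
    where
    open ≤-Reasoning
    endpoint : ∀ {a b v} → Edge S a b → col χ a b ≡ k → T (essential S v k) → a ≡ v ⊎ b ≡ v
    endpoint ab ab≡k v-essential = essential-endpoint v-essential ab ab≡k
  ... | no k∉S = ≤-trans (count-mono (k∉S ∘ colours⁺ ∘ proj₁ ∘ essential⁻))
                         (≤-trans (≤-reflexive count-∅) z≤n)

  2≤weight⇒atMostOneEdge : ∀ {S k} → 2 ≤ weight S k → AtMostOneEdge S k
  2≤weight⇒atMostOneEdge {S} {k} 2≤weight ab a′b′ ab≡k a′b′≡k =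
    samePair-via (through-essentials ab ab≡k) (through-essentials a′b′ a′b′≡k)
    where
    chosen = choose 2≤weight
    v = proj₁ chosen
    v₀≢v₁ : v 0F ≢ v 1F
    v₀≢v₁ v₀≡v₁ = contradiction (proj₁ (proj₂ chosen) {0F} {1F} v₀≡v₁) λ ()
    through-essentials : ∀ {a b} → Edge S a b → col χ a b ≡ k → SamePair a b (v 0F) (v 1F)
    through-essentials ab ab≡k = samePair-of-endpoints (proj₂ (proj₂ ab)) v₀≢v₁
      (essential-endpoint {S} {v 0F} (proj₂ (proj₂ chosen) 0F) ab ab≡k)
      (essential-endpoint {S} {v 1F} (proj₂ (proj₂ chosen) 1F) ab ab≡k)

  colours-cover : ∀ {S v k} → T (S v) → T (colours S k) → T (colours (S ─ v) k) ⊎ T (essential S v k)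
  colours-cover {S} {v} {k} v∈S k∈S with T? (colours (S ─ v) k)
  ... | yes k∈S─v = inj₁ k∈S─v
  ... | no  k∉S─v = inj₂ (essential⁺ (colours⁻ k∈S , v∈S , k∉S─v ∘ colours⁺))

  colours-step : ∀ {S B} → (∀ {v} → T (S v) → ∣ colours (S ─ v) ∣ ≤ B) →
                 ∣ S ∣ * ∣ colours S ∣ ≤ ∣ S ∣ * B + sum (weight S)
  colours-step {S} {B} bound = begin
    ∣ S ∣ * ∣ colours S ∣
      ≡⟨ count-* S _ ⟩
    sum (λ v → ind (S v) * ∣ colours S ∣)
      ≤⟨ sum-mono-≤ pointwise ⟩
    sum (λ v → ind (S v) * B + ∣ essential S v ∣)
      ≡⟨ ∑-distrib-+ (λ v → ind (S v) * B) _ ⟩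
    sum (λ v → ind (S v) * B) + sum (λ v → ∣ essential S v ∣)
      ≡⟨ cong₂ _+_ (count-* S B) (sym (∑-count-comm (essential S))) ⟨
    ∣ S ∣ * B + sum (weight S)
      ∎
    where
    open ≤-Reasoning
    ind-*-≤ : ∀ b {x y z} → (T b → x ≤ y + z) → ind b * x ≤ ind b * y + z
    ind-*-≤ false _ = z≤n
    ind-*-≤ true {x} {y} x≤y+z rewrite +-identityʳ x | +-identityʳ y = x≤y+z tt
    pointwise : ∀ v → ind (S v) * ∣ colours S ∣ ≤ ind (S v) * B + ∣ essential S v ∣
    pointwise v = ind-*-≤ (S v) λ v∈S →
      ≤-trans (count-cover (colours-cover v∈S)) (+-monoˡ-≤ _ (bound v∈S))

  deficiency : Subset n → Fin m → ℕ
  deficiency S k = 2 * ind (colours S k) ∸ weight S k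

  deficit : Subset n → ℕ
  deficit S = sum (deficiency S)

  deficiency-of-weightless : ∀ {S k} → T (colours S k) → weight S k ≡ 0 → deficiency S k ≡ 2
  deficiency-of-weightless k∈S weight≡0 = cong₂ (λ c w → 2 * c ∸ w) (ind-T k∈S) weight≡0

  deficiency≡0⇒2≤weight : ∀ {S k} → T (colours S k) → deficiency S k ≡ 0 → 2 ≤ weight S k
  deficiency≡0⇒2≤weight {S} {k} k∈S deficiency≡0 =
    m∸n≡0⇒m≤n (trans (cong (λ c → 2 * c ∸ weight S k) (sym (ind-T k∈S))) deficiency≡0)

  weight≤1⇒weight≤deficiency : ∀ {S k} → weight S k ≤ 1 → weight S k ≤ deficiency S k
  weight≤1⇒weight≤deficiency {S} {k} w≤1 = light (colours S k) w≤1 (weight≤2 S k)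
    where
    light : ∀ b {w} → w ≤ 1 → w ≤ 2 * ind b → w ≤ 2 * ind b ∸ w
    light false _         z≤n = z≤n
    light true  z≤n       _   = z≤n
    light true  (s≤s z≤n) _   = s≤s z≤n

  weight+deficit : ∀ S → sum (weight S) + deficit S ≡ 2 * ∣ colours S ∣
  weight+deficit S = begin
    sum (weight S) + deficit S               ≡⟨ ∑-distrib-+ (weight S) _ ⟨
    sum (λ k → weight S k + deficiency S k)  ≡⟨ sum-cong-≗ (λ k → m+[n∸m]≡n (weight≤2 S k)) ⟩
    sum (λ k → 2 * ind (colours S k))        ≡⟨ *-distribˡ-sum 2 (ind ∘ colours S) ⟨
    2 * sum (ind ∘ colours S)                ≡⟨ cong (2 *_) ∣∣≡sum ⟨
    2 * ∣ colours S ∣                        ∎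
    where open ≡-Reasoning

  ColourBound : ℕ → ℕ → Set
  ColourBound s B = ∀ S → ∣ S ∣ ≡ s → ∣ colours S ∣ ≤ B

  deficit-step : ∀ {t B S} → ColourBound (suc t) B → ∣ S ∣ ≡ 2 + t →
                 t * ∣ colours S ∣ + deficit S ≤ (2 + t) * B
  deficit-step {t} {B} {S} bound ∣S∣≡2+t = +-cancelˡ-≤ (2 * c) _ _ (begin
    2 * c + (t * c + Δ)        ≡⟨ +-assoc (2 * c) (t * c) Δ ⟨
    2 * c + t * c + Δ          ≡⟨ cong (_+ Δ) (*-distribʳ-+ c 2 t) ⟨
    (2 + t) * c + Δ            ≤⟨ +-monoˡ-≤ Δ step ⟩
    (2 + t) * B + W + Δ        ≡⟨ +-assoc ((2 + t) * B) W Δ ⟩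
    (2 + t) * B + (W + Δ)      ≡⟨ cong ((2 + t) * B +_) (weight+deficit S) ⟩
    (2 + t) * B + 2 * c        ≡⟨ +-comm ((2 + t) * B) (2 * c) ⟩
    2 * c + (2 + t) * B        ∎)
    where
    open ≤-Reasoning
    c = ∣ colours S ∣
    W = sum (weight S)
    Δ = deficit S
    step : (2 + t) * c ≤ (2 + t) * B + W
    step = subst (λ s → s * c ≤ s * B + W) ∣S∣≡2+t (colours-step λ v∈S →
      bound (S ─ _) (suc-injective (trans (sym (count-─ v∈S)) ∣S∣≡2+t)))

  -- The pair {0F, 1F} may have any colour, since every other pair has a colour lying on no other edge.
  rainbowK4 : (S : Subset n) (q : Fin 4 → Fin n) → (∀ i → T (S (q i))) → q 0F ≢ q 1F →
              (∀ i j → i ≢ j → (q i ≢ q j × AtMostOneEdge S (col χ (q i) (q j)))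
                               ⊎ SamePair i j 0F 1F) →
              HasRainbowK4 χ
  rainbowK4 S q q∈S q₀≢q₁ table = q , injective , rainbow
    where
    distinct : ∀ {i j} → i ≢ j → q i ≢ q j
    distinct {i} {j} i≢j with table i j i≢j
    ... | inj₁ (qᵢ≢qⱼ , _)           = qᵢ≢qⱼ
    ... | inj₂ (inj₁ (refl , refl)) = q₀≢q₁
    ... | inj₂ (inj₂ (refl , refl)) = q₀≢q₁ ∘ sym
    injective : Injective _≡_ _≡_ q
    injective {i} {j} qᵢ≡qⱼ with i ≟ j
    ... | yes i≡j = i≡j
    ... | no  i≢j = contradiction qᵢ≡qⱼ (distinct i≢j)
    edge : ∀ {i j} → i ≢ j → Edge S (q i) (q j)
    edge i≢j = q∈S _ , q∈S _ , distinct i≢j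
    rainbow : ∀ i j k l → i ≢ j → k ≢ l → col χ (q i) (q j) ≡ col χ (q k) (q l) → SamePair i j k l
    rainbow i j k l i≢j k≢l same with table i j i≢j | table k l k≢l
    ... | inj₁ (_ , unique) | _ =
      samePair-injective injective (unique (edge i≢j) (edge k≢l) refl (sym same))
    ... | inj₂ _ | inj₁ (_ , unique) =
      samePair-sym (samePair-injective injective (unique (edge k≢l) (edge i≢j) refl same))
    ... | inj₂ ij≐01 | inj₂ kl≐01 = samePair-via ij≐01 kl≐01

  rainbowK4-within : ∀ {R S} → 4 ≤ ∣ R ∣ → R ⊆ S →
                     (∀ {a b} → Edge R a b → AtMostOneEdge S (col χ a b)) → HasRainbowK4 χ
  rainbowK4-within {R} {S} 4≤∣R∣ R⊆S unique =
    rainbowK4 S q (R⊆S ∘ q∈R) (distinct {0F} {1F} λ ()) λ i j i≢j →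
      inj₁ (distinct i≢j , unique (q∈R i , q∈R j , distinct i≢j))
    where
    chosen = choose 4≤∣R∣
    q = proj₁ chosen
    q∈R = proj₂ (proj₂ chosen)
    distinct : ∀ {i j} → i ≢ j → q i ≢ q j
    distinct {i} {j} i≢j = i≢j ∘ proj₁ (proj₂ chosen) {i} {j}

  rainbowKab : ∀ {a b} (f : Fin a → Fin n) (g : Fin b → Fin n) →
               Injective _≡_ _≡_ f → Injective _≡_ _≡_ g → (∀ i j → f i ≢ g j) →
               (∀ i j → AtMostOneEdge full (col χ (f i) (g j))) → HasRainbowKab a b χ
  rainbowKab {a} {b} f g f-inj g-inj f≢g unique = f ++ g , injective , rainbow
    where
    [f,g]-injective : ∀ s t → [ f , g ]′ s ≡ [ f , g ]′ t → s ≡ t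
    [f,g]-injective (inj₁ i) (inj₁ i′) fᵢ≡fᵢ′ = cong inj₁ (f-inj fᵢ≡fᵢ′)
    [f,g]-injective (inj₁ i) (inj₂ j)  fᵢ≡gⱼ  = contradiction fᵢ≡gⱼ (f≢g i j)
    [f,g]-injective (inj₂ j) (inj₁ i)  gⱼ≡fᵢ  = contradiction (sym gⱼ≡fᵢ) (f≢g i j)
    [f,g]-injective (inj₂ j) (inj₂ j′) gⱼ≡gⱼ′ = cong inj₂ (g-inj gⱼ≡gⱼ′)
    injective : Injective _≡_ _≡_ (f ++ g)
    injective {x} {y} fgₓ≡fgᵧ = begin
      x                       ≡⟨ join-splitAt a b x ⟨
      join a b (splitAt a x)  ≡⟨ cong (join a b) ([f,g]-injective (splitAt a x) (splitAt a y) fgₓ≡fgᵧ) ⟩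
      join a b (splitAt a y)  ≡⟨ join-splitAt a b y ⟩
      y                       ∎
      where open ≡-Reasoning
    edge : ∀ i j → Edge full (f i) (g j)
    edge i j = tt , tt , f≢g i j
    rainbow : ∀ i i′ j j′ → col χ ((f ++ g) (i ↑ˡ b)) ((f ++ g) (a ↑ʳ j)) ≡
                            col χ ((f ++ g) (i′ ↑ˡ b)) ((f ++ g) (a ↑ʳ j′)) → i ≡ i′ × j ≡ j′
    rainbow i i′ j j′ same
      rewrite lookup-++ˡ f g i | lookup-++ʳ f g j | lookup-++ˡ f g i′ | lookup-++ʳ f g j′
      with unique i j (edge i j) (edge i′ j′) refl (sym same)
    ... | inj₁ (fᵢ≡fᵢ′ , gⱼ≡gⱼ′) = f-inj fᵢ≡fᵢ′ , g-inj gⱼ≡gⱼ′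
    ... | inj₂ (fᵢ≡gⱼ′ , _)      = contradiction fᵢ≡gⱼ′ (f≢g i j′)

  rainbowK4-of-deficit : ∀ {S} → deficit S + 4 ≤ ∣ S ∣ →
                         (∀ {k} → T (colours S k) → 0 < weight S k) → HasRainbowK4 χ
  rainbowK4-of-deficit {S} small positive = rainbowK4-within 4≤∣S∖Z∣ (proj₁ ∘ ∈∖⁻) unique
    where
    -- Z holds the essential vertices of the light colours (weight ≤ 1). It has at most deficit S
    -- elements, and a light colour has no edge avoiding Z, so edges avoiding Z carry heavy colours.
    essentialLight : Fin m → Subset n
    essentialLight k v = ⌊ weight S k ≤? 1 ⌋ ∧ essential S v k
    Z : Subset n
    Z v = ⌊ any? (λ k → T? (essentialLight k v)) ⌋
    ∣essentialLight∣≤ : ∀ k → ∣ (λ v → ⌊ weight S k ≤? 1 ⌋ ∧ essential S v k) ∣ ≤ deficiency S k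
    ∣essentialLight∣≤ k with weight S k ≤? 1
    ... | yes w≤1 = weight≤1⇒weight≤deficiency w≤1
    ... | no  _   = ≤-trans (≤-reflexive count-∅) z≤n
    ∣Z∣≤deficit : ∣ Z ∣ ≤ deficit S
    ∣Z∣≤deficit = ≤-trans (count-≤-∑ essentialLight toWitness) (sum-mono-≤ ∣essentialLight∣≤)
    S⊆S∖Z∪Z : ∀ {v} → T (S v) → T ((S ∖ Z) v) ⊎ T (Z v)
    S⊆S∖Z∪Z {v} v∈S with T? (Z v)
    ... | yes v∈Z = inj₂ v∈Z
    ... | no  v∉Z = inj₁ (∈∖⁺ v∈S v∉Z)
    4≤∣S∖Z∣ : 4 ≤ ∣ S ∖ Z ∣
    4≤∣S∖Z∣ = +-cancelʳ-≤ (deficit S) 4 _ (begin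
      4 + deficit S          ≡⟨ +-comm 4 _ ⟩
      deficit S + 4          ≤⟨ small ⟩
      ∣ S ∣                  ≤⟨ count-cover S⊆S∖Z∪Z ⟩
      ∣ S ∖ Z ∣ + ∣ Z ∣      ≤⟨ +-monoʳ-≤ _ ∣Z∣≤deficit ⟩
      ∣ S ∖ Z ∣ + deficit S  ∎)
      where open ≤-Reasoning
    unique : ∀ {a b} → Edge (S ∖ Z) a b → AtMostOneEdge S (col χ a b)
    unique {a} {b} (a∈S∖Z , b∈S∖Z , a≢b) with weight S (col χ a b) ≤? 1
    ... | no  w≰1 = 2≤weight⇒atMostOneEdge (≰⇒> w≰1)
    ... | yes w≤1 =
      ⊥-elim ([ outside a∈S∖Z , outside b∈S∖Z ]′ (essential-endpoint z-essential ab refl))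
      where
      ab : Edge S a b
      ab = proj₁ (∈∖⁻ a∈S∖Z) , proj₁ (∈∖⁻ b∈S∖Z) , a≢b
      essential-vertex = ∣∣>0⇒∃ (positive (colours⁺ (a , b , ab , refl)))
      z = proj₁ essential-vertex
      z-essential = proj₂ essential-vertex
      z∈Z : T (Z z)
      z∈Z = fromWitness (col χ a b , Equivalence.from T-∧ (fromWitness w≤1 , z-essential))
      outside : ∀ {x} → T ((S ∖ Z) x) → x ≢ z
      outside x∈S∖Z x≡z = proj₂ (∈∖⁻ x∈S∖Z) (subst (T ∘ Z) (sym x≡z) z∈Z)

  deficit≤1⇒0<weight : ∀ {S k} → deficit S ≤ 1 → T (colours S k) → 0 < weight S k
  deficit≤1⇒0<weight {S} {k} deficit≤1 k∈S = n≢0⇒n>0 λ weight≡0 → contradiction (begin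
    2                ≡⟨ deficiency-of-weightless k∈S weight≡0 ⟨
    deficiency S k   ≤⟨ fᵢ≤sum (deficiency S) k ⟩
    deficit S        ≤⟨ deficit≤1 ⟩
    1                ∎) 1+n≰n
    where open ≤-Reasoning

  m≤∣colours∣ : UsesAllColors χ → m ≤ ∣ colours full ∣
  m≤∣colours∣ uses-all = ≤-trans (≤-reflexive (sym count-full)) (count-mono λ {k} _ →
    let (u , v , u≢v , uv≡k) = uses-all k in colours⁺ (u , v , (tt , tt , u≢v) , uv≡k))

  colourBound₂ : ColourBound 2 1
  colourBound₂ S ∣S∣≡2 = ≤-trans (count-mono colours⊆) (≤-reflexive (count-⁅⁆ (col χ x y)))
    where
    first = ∣∣>0⇒∃ {p = S} (subst (0 <_) (sym ∣S∣≡2) (s≤s z≤n))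
    x = proj₁ first
    ∣S─x∣≡1 : ∣ S ─ x ∣ ≡ 1
    ∣S─x∣≡1 = suc-injective (trans (sym (count-─ (proj₂ first))) ∣S∣≡2)
    second = ∣∣>0⇒∃ {p = S ─ x} (subst (0 <_) (sym ∣S─x∣≡1) (s≤s z≤n))
    y = proj₁ second
    ∣S─x─y∣≡0 : ∣ S ─ x ─ y ∣ ≡ 0
    ∣S─x─y∣≡0 = suc-injective (trans (sym (count-─ (proj₂ second))) ∣S─x∣≡1)
    only : ∀ {z} → T (S z) → z ≡ x ⊎ z ≡ y
    only {z} z∈S with z ≟ x | z ≟ y
    ... | yes z≡x | _       = inj₁ z≡x
    ... | no  _   | yes z≡y = inj₂ z≡y
    ... | no  z≢x | no  z≢y =
      contradiction (subst (0 <_) ∣S─x─y∣≡0 (∈⇒∣∣>0 (∈─⁺ (∈─⁺ z∈S z≢x) z≢y))) λ ()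
    colours⊆ : colours S ⊆ ⁅ col χ x y ⁆
    colours⊆ k∈S with colours⁻ k∈S
    ... | a , b , (a∈S , b∈S , a≢b) , refl with only a∈S | only b∈S
    ... | inj₁ refl | inj₁ refl = contradiction refl a≢b
    ... | inj₁ refl | inj₂ refl = ∈⁅⁆⁺ refl
    ... | inj₂ refl | inj₁ refl = ∈⁅⁆⁺ (col-sym χ y x)
    ... | inj₂ refl | inj₂ refl = contradiction refl a≢b

  colourBound-by-counting : ∀ {t B L} → ColourBound (suc t) B → (2 + t) * B < t * suc L →
                            ColourBound (2 + t) L
  colourBound-by-counting {t} {B} {L} bound too-many S ∣S∣≡2+t with ∣ colours S ∣ ≤? L
  ... | yes c≤L = c≤L
  ... | no  c≰L = contradiction too-many (≤⇒≯ (begin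
    t * suc L                     ≤⟨ *-monoʳ-≤ t (≰⇒> c≰L) ⟩
    t * ∣ colours S ∣             ≤⟨ m≤m+n _ _ ⟩
    t * ∣ colours S ∣ + deficit S ≤⟨ deficit-step bound ∣S∣≡2+t ⟩
    (2 + t) * B                   ∎))
    where open ≤-Reasoning

  module _ (no-K4 : ¬ HasRainbowK4 χ) where

    -- A set beating the bound would have deficit ≤ d ≤ 1, hence a rainbow K4.
    colourBound-by-deficit : ∀ {t B L} d → ColourBound (suc t) B → (2 + t) * B ≡ t * suc L + d →
                             d ≤ 1 → d + 4 ≤ 2 + t → ColourBound (2 + t) L
    colourBound-by-deficit {t} {B} {L} d bound B≡ d≤1 d+4≤2+t S ∣S∣≡2+t with ∣ colours S ∣ ≤? L
    ... | yes c≤L = c≤L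
    ... | no  c≰L =
      contradiction (rainbowK4-of-deficit small (deficit≤1⇒0<weight (≤-trans deficit≤d d≤1))) no-K4
      where
      open ≤-Reasoning
      deficit≤d : deficit S ≤ d
      deficit≤d = +-cancelˡ-≤ (t * suc L) _ _ (begin
        t * suc L + deficit S          ≤⟨ +-monoˡ-≤ _ (*-monoʳ-≤ t (≰⇒> c≰L)) ⟩
        t * ∣ colours S ∣ + deficit S  ≤⟨ deficit-step bound ∣S∣≡2+t ⟩
        (2 + t) * B                    ≡⟨ B≡ ⟩
        t * suc L + d                  ∎)
      small : deficit S + 4 ≤ ∣ S ∣
      small = ≤-trans (+-monoˡ-≤ 4 deficit≤d) (≤-trans d+4≤2+t (≤-reflexive (sym ∣S∣≡2+t)))

    colourBound₇ : ColourBound 7 13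
    colourBound₇ = colourBound-by-deficit 0 colourBound₆ refl z≤n (≤ᵇ⇒≤ 4 7 tt)
      where
      colourBound₃ : ColourBound 3 3
      colourBound₃ = colourBound-by-counting colourBound₂ ≤-refl
      colourBound₄ : ColourBound 4 5
      colourBound₄ = colourBound-by-deficit 0 colourBound₃ refl z≤n ≤-refl
      colourBound₅ : ColourBound 5 7
      colourBound₅ = colourBound-by-deficit 1 colourBound₄ refl (s≤s z≤n) ≤-refl
      colourBound₆ : ColourBound 6 10
      colourBound₆ = colourBound-by-counting colourBound₅ (≤ᵇ⇒≤ 43 44 tt)

    deficit≤2 : ∀ {S} → ∣ S ∣ ≡ 8 → 17 ≤ ∣ colours S ∣ → deficit S ≤ 2
    deficit≤2 ∣S∣≡8 17≤c = +-cancelˡ-≤ 102 _ 2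
      (≤-trans (+-monoˡ-≤ _ (*-monoʳ-≤ 6 17≤c)) (deficit-step colourBound₇ ∣S∣≡8))

-- The deficit ≤ 2 of K8 is used up by X, so every other colour lies on a single edge; N is the graph
-- of the remaining edges.
module WeightlessColour (χ : EdgeColoring 8 (Fin 17)) (no-K4 : ¬ HasRainbowK4 χ)
                        (uses-all : UsesAllColors χ) (X : Fin 17)
                        (X-occurs : T (colours χ full X)) (X-weightless : weight χ full X ≡ 0) where

  NonX : Fin 8 → Fin 8 → Set
  NonX x y = x ≢ y × col χ x y ≢ X

  nonX-sym : ∀ {x y} → NonX x y → NonX y x
  nonX-sym {x} {y} (x≢y , xy≢X) = x≢y ∘ sym , xy≢X ∘ trans (col-sym χ x y)

  N : Fin 8 → Subset 8
  N x y = ⌊ ¬? (x ≟ y) ×-dec ¬? (col χ x y ≟ X) ⌋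

  nonX⇒atMostOneEdge : ∀ {x y} → NonX x y → AtMostOneEdge χ full (col χ x y)
  nonX⇒atMostOneEdge {x} {y} (x≢y , xy≢X) =
    2≤weight⇒atMostOneEdge χ (deficiency≡0⇒2≤weight χ xy-occurs (n≤0⇒n≡0 (+-cancelˡ-≤ 2 _ 0 (begin
      2 + d                    ≡⟨ cong (_+ d) (deficiency-of-weightless χ X-occurs X-weightless) ⟨
      deficiency χ full X + d  ≤⟨ fᵢ+fⱼ≤sum (deficiency χ full) (xy≢X ∘ sym) ⟩
      deficit χ full           ≤⟨ deficit≤2 χ no-K4 count-full (m≤∣colours∣ χ uses-all) ⟩
      2                        ∎))))
    where
    open ≤-Reasoning
    xy-occurs : T (colours χ full (col χ x y))
    xy-occurs = colours⁺ χ (x , y , (tt , tt , x≢y) , refl)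
    d = deficiency χ full (col χ x y)

  K4⁻-free : ∀ {p₀ p₁ p₂ p₃} → p₀ ≢ p₁ →
             NonX p₀ p₂ → NonX p₀ p₃ → NonX p₁ p₂ → NonX p₁ p₃ → NonX p₂ p₃ → ⊥
  K4⁻-free {p₀} {p₁} {p₂} {p₃} p₀≢p₁ n₀₂ n₀₃ n₁₂ n₁₃ n₂₃ =
    no-K4 (rainbowK4 χ full q (λ _ → tt) p₀≢p₁ table)
    where
    q : Fin 4 → Fin 8
    q = p₀ ∷ p₁ ∷ p₂ ∷ p₃ ∷ []
    good : ∀ {x y} → NonX x y → x ≢ y × AtMostOneEdge χ full (col χ x y)
    good xy = proj₁ xy , nonX⇒atMostOneEdge xy
    table : ∀ i j → i ≢ j →
            (q i ≢ q j × AtMostOneEdge χ full (col χ (q i) (q j))) ⊎ SamePair i j 0F 1F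
    table 0F 0F i≢j = contradiction refl i≢j
    table 0F 1F _   = inj₂ (inj₁ (refl , refl))
    table 0F 2F _   = inj₁ (good n₀₂)
    table 0F 3F _   = inj₁ (good n₀₃)
    table 1F 0F _   = inj₂ (inj₂ (refl , refl))
    table 1F 1F i≢j = contradiction refl i≢j
    table 1F 2F _   = inj₁ (good n₁₂)
    table 1F 3F _   = inj₁ (good n₁₃)
    table 2F 0F _   = inj₁ (good (nonX-sym n₀₂))
    table 2F 1F _   = inj₁ (good (nonX-sym n₁₂))
    table 2F 2F i≢j = contradiction refl i≢j
    table 2F 3F _   = inj₁ (good n₂₃)
    table 3F 0F _   = inj₁ (good (nonX-sym n₀₃))
    table 3F 1F _   = inj₁ (good (nonX-sym n₁₃))
    table 3F 2F _   = inj₁ (good (nonX-sym n₂₃))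
    table 3F 3F i≢j = contradiction refl i≢j

  -- Deleting v loses at least 17 − 13 colours, each on an edge at v that is not coloured X.
  degree≥4 : ∀ v → 4 ≤ ∣ N v ∣
  degree≥4 v = ≤-trans 4≤∣essential∣ (count-image (col χ v) essential-nonX)
    where
    open ≤-Reasoning
    ∣full─v∣≡7 : ∣ full ─ v ∣ ≡ 7
    ∣full─v∣≡7 = suc-injective (trans (sym (count-─ tt)) count-full)
    4≤∣essential∣ : 4 ≤ ∣ essential χ full v ∣
    4≤∣essential∣ = +-cancelˡ-≤ 13 _ _ (begin
      17
        ≤⟨ m≤∣colours∣ χ uses-all ⟩
      ∣ colours χ full ∣
        ≤⟨ count-cover (colours-cover χ tt) ⟩
      ∣ colours χ (full ─ v) ∣ + ∣ essential χ full v ∣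
        ≤⟨ +-monoˡ-≤ _ (colourBound₇ χ no-K4 (full ─ v) ∣full─v∣≡7) ⟩
      13 + ∣ essential χ full v ∣
        ∎)
    essential-nonX : ∀ {k} → T (essential χ full v k) → ∃ λ x → T (N v x) × col χ v x ≡ k
    essential-nonX {k} v-essential with essential-image χ v-essential
    ... | x , (_ , _ , v≢x) , vx≡k = x , fromWitness (v≢x , vx≢X) , vx≡k
      where
      vx≢X : col χ v x ≢ X
      vx≢X vx≡X = contradiction (subst (0 <_) X-weightless
        (∈⇒∣∣>0 (subst (T ∘ essential χ full v) (trans (sym vx≡k) vx≡X) v-essential))) λ ()

  common-neighbour : ∀ {v a b x} → NonX v a → NonX v b → NonX a b → NonX a x → NonX b x → x ≡ v
  common-neighbour {v} {x = x} va vb ab ax bx with x ≟ v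
  ... | yes x≡v = x≡v
  ... | no  x≢v = ⊥-elim (K4⁻-free x≢v (nonX-sym ax) (nonX-sym bx) va vb ab)

  -- Two corners of the triangle have no common neighbour besides the third (it would span a K4⁻),
  -- so the neighbourhoods overlap pairwise in at most one vertex and their sizes add up to at most 11.
  triangle-free : ∀ {v a b} → NonX v a → NonX v b → NonX a b → ⊥
  triangle-free {v} {a} {b} va vb ab = contradiction (begin
    12
      ≤⟨ +-mono-≤ (+-mono-≤ (degree≥4 v) (degree≥4 a)) (degree≥4 b) ⟩
    ∣ N v ∣ + ∣ N a ∣ + ∣ N b ∣
      ≤⟨ count-three-overlaps (N v) (N a) (N b) ⟩
    8 + ∣ N a ∩ N b ∣ + ∣ N v ∩ N b ∣ + ∣ N v ∩ N a ∣
      ≤⟨ +-mono-≤ (+-mono-≤ (+-monoʳ-≤ 8 (at-most-one (common-neighbour va vb ab)))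
                            (at-most-one (common-neighbour (nonX-sym va) ab vb)))
                  (at-most-one (common-neighbour (nonX-sym vb) (nonX-sym ab) va)) ⟩
    11
      ∎) 1+n≰n
    where
    open ≤-Reasoning
    at-most-one : ∀ {y z c} → (∀ {x} → NonX y x → NonX z x → x ≡ c) → ∣ N y ∩ N z ∣ ≤ 1
    at-most-one only-c = ≤-trans (count-mono λ x∈ → let (x∈Ny , x∈Nz) = ∈∩⁻ x∈ in
                                    ∈⁅⁆⁺ (only-c (toWitness x∈Ny) (toWitness x∈Nz)))
                                 (≤-reflexive (count-⁅⁆ _))

  -- A = N 0F is independent, so the ≥ 4 neighbours of any u ∈ A fill its complement B,
  -- which has ≤ 4 vertices.
  rainbowK44 : HasRainbowKab 4 4 χ
  rainbowK44 = rainbowKab χ f g (proj₁ (proj₂ f-chosen)) (proj₁ (proj₂ g-chosen)) f≢g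
    λ i j → nonX⇒atMostOneEdge (toWitness (B⊆N (f∈A i) (g∈B j)))
    where
    A B : Subset 8
    A = N 0F
    B = full ∖ A
    N⊆B : ∀ {u} → T (A u) → N u ⊆ B
    N⊆B u∈A x∈Nu = ∈∖⁺ tt λ x∈A →
      triangle-free (toWitness u∈A) (toWitness x∈A) (toWitness x∈Nu)
    ∣B∣+∣A∣≡8 : ∣ B ∣ + ∣ A ∣ ≡ 8
    ∣B∣+∣A∣≡8 = trans (sym (count-∖ (λ _ → tt))) count-full
    ∣B∣≤4 : ∣ B ∣ ≤ 4
    ∣B∣≤4 = +-cancelʳ-≤ 4 _ _ (≤-trans (+-monoʳ-≤ ∣ B ∣ (degree≥4 0F)) (≤-reflexive ∣B∣+∣A∣≡8))
    B⊆N : ∀ {u} → T (A u) → B ⊆ N u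
    B⊆N {u} u∈A = p⊆q∧∣q∣≤∣p∣⇒q⊆p (N⊆B u∈A) (≤-trans ∣B∣≤4 (degree≥4 u))
    u∈A = ∣∣>0⇒∃ (≤-trans (s≤s z≤n) (degree≥4 0F))
    f-chosen = choose (degree≥4 0F)
    g-chosen = choose (≤-trans (degree≥4 _) (count-mono (N⊆B (proj₂ u∈A))))
    f = proj₁ f-chosen
    g = proj₁ g-chosen
    f∈A = proj₂ (proj₂ f-chosen)
    g∈B = proj₂ (proj₂ g-chosen)
    f≢g : ∀ i j → f i ≢ g j
    f≢g i j fᵢ≡gⱼ = proj₂ (∈∖⁻ (g∈B j)) (subst (T ∘ A) fᵢ≡gⱼ (f∈A i))

lemma7 : (χ : EdgeColoring 8 (Fin 17)) → UsesAllColors χ → ¬ HasRainbowK4 χ →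
    HasRainbowKab 4 4 χ
lemma7 χ uses-all no-K4 with any? (λ X → T? (colours χ full X) ×-dec (weight χ full X ≟ℕ 0))
... | yes (X , X-occurs , X-weightless) =
  WeightlessColour.rainbowK44 χ no-K4 uses-all X X-occurs X-weightless
... | no  no-weightless = contradiction (rainbowK4-of-deficit χ small positive) no-K4
  where
  small : deficit χ full + 4 ≤ ∣ full ∣
  small = ≤-trans (+-monoˡ-≤ 4 (deficit≤2 χ no-K4 count-full (m≤∣colours∣ χ uses-all)))
                  (≤-trans (≤ᵇ⇒≤ 6 8 _) (≤-reflexive (sym count-full)))
  positive : ∀ {k} → T (colours χ full k) → 0 < weight χ full k
  positive k-occurs = n≢0⇒n>0 λ weight≡0 → no-weightless (_ , k-occurs , weight≡0)
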